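{- Let $T=(\bar v,\mathit{Init},\mathit{Tr},\mathit{Bad})$ be a transition system and let $\bar a$ be an ordered set of auxiliary variables with auxiliary circuit $E(\bar v,\bar a)$. If $\mathit{Inv}_g(\bar v,\bar a)$ is a generalized safe inductive invariant for $T$ with respect to $E$, then there exists a safe inductive invariant $\mathit{Inv}(\bar v)$ for $T$, i.e. a formula over $\bar v$ alone with $\mathit{Init}(\bar v)\Rightarrow\mathit{Inv}(\bar v)$, $\mathit{Inv}(\bar v)\land\mathit{Tr}(\bar v,\bar v')\Rightarrow\mathit{Inv}(\bar v')$ and $\mathit{Inv}(\bar v)\Rightarrow\neg\mathit{Bad}(\bar v)$.
   Context: A transition system $T=(\bar v,\mathit{Init},\mathit{Tr},\mathit{Bad})$ consists of a finite set $\bar v$ of Boolean variables, propositional formulas $\mathit{Init}(\bar v)$, $\mathit{Bad}(\bar v)$, and a propositional formula $\mathit{Tr}(\bar v,\bar v')$ over $\bar v$ and a primed copy $\bar v'$. An auxiliary circuit for an ordered set $\bar a=\{a_1,\ldots,a_m\}$ ($m\ge 0$) of fresh Boolean variables is a formula $E(\bar v,\bar a)=\bigwedge_{i=1}^{m}(a_i\leftrightarrow l_{i_1}\star_i l_{i_2})$ (the empty conjunction $\top$ if $m=0$) where $\star_i\in\{\land,\oplus\}$ ($\oplus$ = exclusive or) and $l_{i_1},l_{i_2}$ are literals over $\bar v\cup\{a_j:j<i\}$; $E(\bar v',\bar a')$ denotes its primed copy. A generalized safe inductive invariant with respect to $E$ is a formula $\mathit{Inv}(\bar v,\bar a)$ such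 that (1) $\mathit{Init}(\bar v)\land E(\bar v,\bar a)\Rightarrow \mathit{Inv}(\bar v,\bar a)$; (2) $\mathit{Inv}(\bar v,\bar a)\land E(\bar v,\bar a)\land \mathit{Tr}(\bar v,\bar v')\land E(\bar v',\bar a')\Rightarrow \mathit{Inv}(\bar v',\bar a')$; (3) $\mathit{Inv}(\bar v,\bar a)\land E(\bar v,\bar a)\Rightarrow\neg\mathit{Bad}(\bar v)$, all implications being validities. -}

module Defs where

open import Data.Bool using (Bool; true; false; not; _∧_; _∨_; _xor_; T)
open import Data.Nat using (ℕ; zero; suc)
open import Data.Fin using (Fin; toℕ)
open import Data.Sum using (_⊎_; inj₁; inj₂; [_,_])

data Formula (X : Set) : Set where
  var  : X → Formula X
  ⊤f   : Formula X
  ⊥f   : Formula X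
  ¬f_  : Formula X → Formula X
  _∧f_ : Formula X → Formula X → Formula X
  _∨f_ : Formula X → Formula X → Formula X

infixr 6 _∧f_
infixr 5 _∨f_

_⇒f_ : {X : Set} → Formula X → Formula X → Formula X
φ ⇒f ψ = (¬f φ) ∨f ψ

⟦_⟧ : {X : Set} → Formula X → (X → Bool) → Bool
⟦ var x ⟧ σ = σ x
⟦ ⊤f ⟧ σ = true
⟦ ⊥f ⟧ σ = false
⟦ ¬f φ ⟧ σ = not (⟦ φ ⟧ σ)
⟦ φ ∧f ψ ⟧ σ = ⟦ φ ⟧ σ ∧ ⟦ ψ ⟧ σ
⟦ φ ∨f ψ ⟧ σ = ⟦ φ ⟧ σ ∨ ⟦ ψ ⟧ σ

Valid : {X : Set} → Formula X → Set
Valid {X} φ = (σ : X → Bool) → T (⟦ φ ⟧ σ)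

rename : {X Y : Set} → (X → Y) → Formula X → Formula Y
rename f (var x) = var (f x)
rename f ⊤f = ⊤f
rename f ⊥f = ⊥f
rename f (¬f φ) = ¬f rename f φ
rename f (φ ∧f ψ) = rename f φ ∧f rename f ψ
rename f (φ ∨f ψ) = rename f φ ∨f rename f ψ

_⇔f_ : {X : Set} → Formula X → Formula X → Formula X
φ ⇔f ψ = (φ ∧f ψ) ∨f ((¬f φ) ∧f (¬f ψ))

_⊕f_ : {X : Set} → Formula X → Formula X → Formula X
φ ⊕f ψ = (φ ∧f (¬f ψ)) ∨f ((¬f φ) ∧f ψ)

-- Transition systems over n state variables v = Fin n.
-- Tr is over v ∪ v' : inj₁ i = v_i, inj₂ i = v'_i.

record TransitionSystem (n : ℕ) : Set where
  field
    Init : Formula (Fin n)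
    Tr   : Formula (Fin n ⊎ Fin n)
    Bad  : Formula (Fin n)

data GateOp : Set where
  AND XOR : GateOp

record Literal (X : Set) : Set where
  constructor lit
  field
    polarity : Bool      -- true = positive, false = negated
    variable′ : X

litFormula : {X : Set} → Literal X → Formula X
litFormula (lit true x)  = var x
litFormula (lit false x) = ¬f (var x)

-- Gate number i (0-based, i.e. a_{i+1}) : a_i ↔ l₁ ⋆ l₂ with l₁, l₂
-- literals over v ∪ {a_j : j < i}.
record Gate (n i : ℕ) : Set where
  constructor gate
  field
    op : GateOp
    l₁ : Literal (Fin n ⊎ Fin i)
    l₂ : Literal (Fin n ⊎ Fin i)

AuxCircuit : ℕ → ℕ → Set
AuxCircuit n m = (i : Fin m) → Gate n (toℕ i)

lowerIdx : {m : ℕ} (i : Fin m) → Fin (toℕ i) → Fin m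
lowerIdx {suc m} Fin.zero ()
lowerIdx {suc m} (Fin.suc i) Fin.zero = Fin.zero
lowerIdx {suc m} (Fin.suc i) (Fin.suc j) = Fin.suc (lowerIdx i j)

gateVars : {n m : ℕ} (i : Fin m) → Fin n ⊎ Fin (toℕ i) → Fin n ⊎ Fin m
gateVars i (inj₁ x) = inj₁ x
gateVars i (inj₂ j) = inj₂ (lowerIdx i j)

opFormula : {X : Set} → GateOp → Formula X → Formula X → Formula X
opFormula AND φ ψ = φ ∧f ψ
opFormula XOR φ ψ = φ ⊕f ψ

gateFormula : {n m : ℕ} → AuxCircuit n m → Fin m → Formula (Fin n ⊎ Fin m)
gateFormula {n} {m} E i with E i
... | gate op l₁ l₂ =
  var (inj₂ i) ⇔f rename (gateVars i)
                    (opFormula op (litFormula l₁) (litFormula l₂))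

bigAnd : {X : Set} {m : ℕ} → (Fin m → Formula X) → Formula X
bigAnd {m = zero}  f = ⊤f
bigAnd {m = suc m} f = f Fin.zero ∧f bigAnd (λ i → f (Fin.suc i))

circuitFormula : {n m : ℕ} → AuxCircuit n m → Formula (Fin n ⊎ Fin m)
circuitFormula E = bigAnd (gateFormula E)

IsSafeInductiveInvariant : {n : ℕ} → TransitionSystem n → Formula (Fin n) → Set
IsSafeInductiveInvariant T Inv =
  Valid (Init ⇒f Inv)
  × Valid ((rename inj₁ Inv ∧f Tr) ⇒f rename inj₂ Inv)
  × Valid (Inv ⇒f (¬f Bad))
  where
    open TransitionSystem T
    open import Data.Product using (_×_)

IsGenSafeInductiveInvariant : {n m : ℕ} → TransitionSystem n →
  AuxCircuit n m → Formula (Fin n ⊎ Fin m) → Set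
IsGenSafeInductiveInvariant {n} {m} T E Inv =
  Valid ((rename inj₁ Init ∧f Eva) ⇒f Inv)
  × Valid ((rename inj₁ Inv ∧f rename inj₁ Eva ∧f rename trV Tr ∧f rename inj₂ Eva)
             ⇒f rename inj₂ Inv)
  × Valid ((Inv ∧f Eva) ⇒f (¬f rename inj₁ Bad))
  where
    open TransitionSystem T
    open import Data.Product using (_×_)
    Eva = circuitFormula E
    -- v_i ↦ (v,a) copy, v'_i ↦ (v',a') copy
    trV : Fin n ⊎ Fin n → (Fin n ⊎ Fin m) ⊎ (Fin n ⊎ Fin m)
    trV (inj₁ x) = inj₁ (inj₁ x)
    trV (inj₂ x) = inj₂ (inj₁ x)

{-# OPTIONS --safe #-}
module Submission where

-- Each gate defines a_i from v and earlier auxiliary variables, so unfolding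
-- the definitions expresses every a_i as a formula over v alone, and every
-- assignment to v extends, by evaluating these formulas, to one satisfying E.
-- Substituting the unfolded definitions into Inv_g gives a formula over v that
-- holds at σ iff Inv_g holds at the extension of σ; the three conditions on
-- Inv_g, instantiated at extensions, then become those of a safe inductive
-- invariant.

open import Defs
open import Data.Bool using (Bool; true; false; not; _∧_; _∨_; T)
open import Data.Bool.Properties using (T-∧)
open import Data.Fin using (Fin; toℕ)
open import Data.Fin.Properties using (toℕ<n)
open import Data.Nat using (ℕ; zero; suc; _<_; z≤n; s≤s)
open import Data.Nat.Properties using (<-≤-trans)
open import Data.Product using (∃; _,_; proj₁; proj₂)
open import Data.Sum using (_⊎_; inj₁; inj₂; [_,_]′)
open import Data.Unit using (tt)
open import Function.Bundles using (_⇔_; mk⇔; Equivalence)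
open import Relation.Binary.PropositionalEquality
  using (_≡_; refl; sym; trans; cong; cong₂; subst; module ≡-Reasoning)

open Equivalence using (to; from)

T-⇒ : ∀ {x y} → T (not x ∨ y) ⇔ (T x → T y)
T-⇒ {false} = mk⇔ (λ _ ()) (λ _ → tt)
T-⇒ {true}  = mk⇔ (λ y _ → y) (λ f → f tt)

T-⇔ : ∀ {x y} → x ≡ y → T ((x ∧ y) ∨ (not x ∧ not y))
T-⇔ {false} refl = tt
T-⇔ {true}  refl = tt

substitute : {X Y : Set} → (X → Formula Y) → Formula X → Formula Y
substitute s (var x)  = s x
substitute s ⊤f       = ⊤f
substitute s ⊥f       = ⊥f
substitute s (¬f φ)   = ¬f substitute s φ
substitute s (φ ∧f ψ) = substitute s φ ∧f substitute s ψ
substitute s (φ ∨f ψ) = substitute s φ ∨f substitute s ψ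

⟦⟧-cong : {X : Set} (φ : Formula X) {σ τ : X → Bool} →
          (∀ x → σ x ≡ τ x) → ⟦ φ ⟧ σ ≡ ⟦ φ ⟧ τ
⟦⟧-cong (var x)  σ≗τ = σ≗τ x
⟦⟧-cong ⊤f       σ≗τ = refl
⟦⟧-cong ⊥f       σ≗τ = refl
⟦⟧-cong (¬f φ)   σ≗τ = cong not (⟦⟧-cong φ σ≗τ)
⟦⟧-cong (φ ∧f ψ) σ≗τ = cong₂ _∧_ (⟦⟧-cong φ σ≗τ) (⟦⟧-cong ψ σ≗τ)
⟦⟧-cong (φ ∨f ψ) σ≗τ = cong₂ _∨_ (⟦⟧-cong φ σ≗τ) (⟦⟧-cong ψ σ≗τ)

⟦rename⟧ : {X Y : Set} (g : X → Y) (φ : Formula X) (σ : Y → Bool) →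
           ⟦ rename g φ ⟧ σ ≡ ⟦ φ ⟧ (λ x → σ (g x))
⟦rename⟧ g (var x)  σ = refl
⟦rename⟧ g ⊤f       σ = refl
⟦rename⟧ g ⊥f       σ = refl
⟦rename⟧ g (¬f φ)   σ = cong not (⟦rename⟧ g φ σ)
⟦rename⟧ g (φ ∧f ψ) σ = cong₂ _∧_ (⟦rename⟧ g φ σ) (⟦rename⟧ g ψ σ)
⟦rename⟧ g (φ ∨f ψ) σ = cong₂ _∨_ (⟦rename⟧ g φ σ) (⟦rename⟧ g ψ σ)

⟦rename⟧-≗ : {X Y : Set} (g : X → Y) (φ : Formula X) {σ : X → Bool} {τ : Y → Bool} →
             (∀ x → τ (g x) ≡ σ x) → ⟦ rename g φ ⟧ τ ≡ ⟦ φ ⟧ σ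
⟦rename⟧-≗ g φ τ∘g≗σ = trans (⟦rename⟧ g φ _) (⟦⟧-cong φ τ∘g≗σ)

⟦substitute⟧ : {X Y : Set} (s : X → Formula Y) (φ : Formula X) (σ : Y → Bool) →
               ⟦ substitute s φ ⟧ σ ≡ ⟦ φ ⟧ (λ x → ⟦ s x ⟧ σ)
⟦substitute⟧ s (var x)  σ = refl
⟦substitute⟧ s ⊤f       σ = refl
⟦substitute⟧ s ⊥f       σ = refl
⟦substitute⟧ s (¬f φ)   σ = cong not (⟦substitute⟧ s φ σ)
⟦substitute⟧ s (φ ∧f ψ) σ = cong₂ _∧_ (⟦substitute⟧ s φ σ) (⟦substitute⟧ s ψ σ)
⟦substitute⟧ s (φ ∨f ψ) σ = cong₂ _∨_ (⟦substitute⟧ s φ σ) (⟦substitute⟧ s ψ σ)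

⟦bigAnd⟧-intro : {X : Set} {m : ℕ} (f : Fin m → Formula X) {σ : X → Bool} →
                 (∀ i → T (⟦ f i ⟧ σ)) → T (⟦ bigAnd f ⟧ σ)
⟦bigAnd⟧-intro {m = zero}  f all = tt
⟦bigAnd⟧-intro {m = suc m} f all =
  from T-∧ (all Fin.zero , ⟦bigAnd⟧-intro (λ i → f (Fin.suc i)) (λ i → all (Fin.suc i)))

toℕ-lowerIdx< : {m : ℕ} (i : Fin m) (j : Fin (toℕ i)) → toℕ (lowerIdx i j) < toℕ i
toℕ-lowerIdx< (Fin.suc i) Fin.zero    = s≤s z≤n
toℕ-lowerIdx< (Fin.suc i) (Fin.suc j) = s≤s (toℕ-lowerIdx< i j)

gateOutput : {n i : ℕ} → Gate n i → Formula (Fin n ⊎ Fin i)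
gateOutput (gate op l₁ l₂) = opFormula op (litFormula l₁) (litFormula l₂)

module Unfolding {n m : ℕ} (E : AuxCircuit n m) where

  gateFormula-≡ : ∀ i → gateFormula E i ≡ (var (inj₂ i) ⇔f rename (gateVars i) (gateOutput (E i)))
  gateFormula-≡ i with E i
  ... | gate op l₁ l₂ = refl

  -- k rounds of unfolding define every a_i with i < k; zero rounds give the junk value ⊥f.
  mutual
    unfoldVar : ℕ → Fin n ⊎ Fin m → Formula (Fin n)
    unfoldVar k (inj₁ x) = var x
    unfoldVar k (inj₂ i) = unfoldAux k i

    unfoldAux : ℕ → Fin m → Formula (Fin n)
    unfoldAux zero    i = ⊥f
    unfoldAux (suc k) i = substitute (λ y → unfoldVar k (gateVars i y)) (gateOutput (E i))

  ⟦unfoldAux⟧-suc : ∀ k i σ →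
    ⟦ unfoldAux (suc k) i ⟧ σ ≡ ⟦ gateOutput (E i) ⟧ (λ y → ⟦ unfoldVar k (gateVars i y) ⟧ σ)
  ⟦unfoldAux⟧-suc k i σ = ⟦substitute⟧ _ (gateOutput (E i)) σ

  ⟦unfoldAux⟧-stable : ∀ {k} i σ → toℕ i < k → ⟦ unfoldAux k i ⟧ σ ≡ ⟦ unfoldAux (suc k) i ⟧ σ
  ⟦unfoldAux⟧-stable {suc k} i σ (s≤s i≤k) = begin
    ⟦ unfoldAux (suc k) i ⟧ σ
      ≡⟨ ⟦unfoldAux⟧-suc k i σ ⟩
    ⟦ gateOutput (E i) ⟧ (λ y → ⟦ unfoldVar k (gateVars i y) ⟧ σ)
      ≡⟨ ⟦⟧-cong (gateOutput (E i)) inputs-stable ⟩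
    ⟦ gateOutput (E i) ⟧ (λ y → ⟦ unfoldVar (suc k) (gateVars i y) ⟧ σ)
      ≡⟨ sym (⟦unfoldAux⟧-suc (suc k) i σ) ⟩
    ⟦ unfoldAux (suc (suc k)) i ⟧ σ ∎
    where
    open ≡-Reasoning
    inputs-stable : ∀ y → ⟦ unfoldVar k (gateVars i y) ⟧ σ ≡ ⟦ unfoldVar (suc k) (gateVars i y) ⟧ σ
    inputs-stable (inj₁ x) = refl
    inputs-stable (inj₂ j) = ⟦unfoldAux⟧-stable (lowerIdx i j) σ (<-≤-trans (toℕ-lowerIdx< i j) i≤k)

  definition : Fin n ⊎ Fin m → Formula (Fin n)
  definition = unfoldVar m

  extend : (Fin n → Bool) → Fin n ⊎ Fin m → Bool
  extend σ y = ⟦ definition y ⟧ σ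

  extend-satisfies : ∀ σ → T (⟦ circuitFormula E ⟧ (extend σ))
  extend-satisfies σ = ⟦bigAnd⟧-intro (gateFormula E) λ i →
    subst T (cong (λ φ → ⟦ φ ⟧ (extend σ)) (sym (gateFormula-≡ i))) (T-⇔ (gate-holds i))
    where
    open ≡-Reasoning
    gate-holds : ∀ i → extend σ (inj₂ i) ≡ ⟦ rename (gateVars i) (gateOutput (E i)) ⟧ (extend σ)
    gate-holds i = begin
      ⟦ unfoldAux m i ⟧ σ                                             ≡⟨ ⟦unfoldAux⟧-stable i σ (toℕ<n i) ⟩
      ⟦ unfoldAux (suc m) i ⟧ σ                                       ≡⟨ ⟦unfoldAux⟧-suc m i σ ⟩
      ⟦ gateOutput (E i) ⟧ (λ y → extend σ (gateVars i y))            ≡⟨ sym (⟦rename⟧ (gateVars i) (gateOutput (E i)) (extend σ)) ⟩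
      ⟦ rename (gateVars i) (gateOutput (E i)) ⟧ (extend σ)           ∎

module Elimination {n m : ℕ} (S : TransitionSystem n) (E : AuxCircuit n m)
                   (Invg : Formula (Fin n ⊎ Fin m))
                   (gen : IsGenSafeInductiveInvariant S E Invg) where

  open TransitionSystem S
  open Unfolding E

  Inv : Formula (Fin n)
  Inv = substitute definition Invg

  ⟦Inv⟧ : ∀ σ → ⟦ Inv ⟧ σ ≡ ⟦ Invg ⟧ (extend σ)
  ⟦Inv⟧ = ⟦substitute⟧ definition Invg

  Inv-initial : Valid (Init ⇒f Inv)
  Inv-initial σ = from T-⇒ λ init →
    subst T (sym (⟦Inv⟧ σ))
      (to T-⇒ (proj₁ gen (extend σ))
        (from T-∧ (subst T (sym (⟦rename⟧ inj₁ Init (extend σ))) init , extend-satisfies σ)))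

  Inv-safe : Valid (Inv ⇒f (¬f Bad))
  Inv-safe σ = from T-⇒ λ inv →
    subst T (cong not (⟦rename⟧ inj₁ Bad (extend σ)))
      (to T-⇒ (proj₂ (proj₂ gen) (extend σ))
        (from T-∧ (subst T (⟦Inv⟧ σ) inv , extend-satisfies σ)))

  Inv-inductive : Valid ((rename inj₁ Inv ∧f Tr) ⇒f rename inj₂ Inv)
  Inv-inductive σ = from T-⇒ λ pre →
    let inv , tr = to T-∧ pre in
    next (to T-⇒ (proj₁ (proj₂ gen) τ)
      (from T-∧ (current inv
      , from T-∧ (satisfies inj₁ σ₀ (λ _ → refl)
      -- the renaming of Tr in the step condition is local to IsGenSafeInductiveInvariant
      , from T-∧ (transition _ (λ { (inj₁ x) → refl ; (inj₂ x) → refl }) tr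
      , satisfies inj₂ σ′ (λ _ → refl))))))
    where
    σ₀ σ′ : Fin n → Bool
    σ₀ x = σ (inj₁ x)
    σ′ x = σ (inj₂ x)

    τ : (Fin n ⊎ Fin m) ⊎ (Fin n ⊎ Fin m) → Bool
    τ = [ extend σ₀ , extend σ′ ]′

    current : T (⟦ rename inj₁ Inv ⟧ σ) → T (⟦ rename inj₁ Invg ⟧ τ)
    current = subst T (trans (⟦rename⟧ inj₁ Inv σ) (trans (⟦Inv⟧ σ₀) (sym (⟦rename⟧ inj₁ Invg τ))))

    next : T (⟦ rename inj₂ Invg ⟧ τ) → T (⟦ rename inj₂ Inv ⟧ σ)
    next = subst T (trans (⟦rename⟧ inj₂ Invg τ) (sym (trans (⟦rename⟧ inj₂ Inv σ) (⟦Inv⟧ σ′))))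

    satisfies : (g : Fin n ⊎ Fin m → (Fin n ⊎ Fin m) ⊎ (Fin n ⊎ Fin m)) (ρ : Fin n → Bool) →
                (∀ y → τ (g y) ≡ extend ρ y) → T (⟦ rename g (circuitFormula E) ⟧ τ)
    satisfies g ρ τ∘g≗extend =
      subst T (sym (⟦rename⟧-≗ g (circuitFormula E) τ∘g≗extend)) (extend-satisfies ρ)

    transition : (g : Fin n ⊎ Fin n → (Fin n ⊎ Fin m) ⊎ (Fin n ⊎ Fin m)) →
                 (∀ x → τ (g x) ≡ σ x) → T (⟦ Tr ⟧ σ) → T (⟦ rename g Tr ⟧ τ)
    transition g τ∘g≗σ = subst T (sym (⟦rename⟧-≗ g Tr τ∘g≗σ))

lemma4 : {n m : ℕ} (T : TransitionSystem n) (E : AuxCircuit n m)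
         (Invg : Formula (Fin n ⊎ Fin m)) →
         IsGenSafeInductiveInvariant T E Invg →
         ∃ λ (Inv : Formula (Fin n)) → IsSafeInductiveInvariant T Inv
lemma4 S E Invg gen = Inv , Inv-initial , Inv-inductive , Inv-safe
  where open Elimination S E Invg gen
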